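{- Let $n\ge 0$ be an integer. An SP-game $G$ whose legal complex satisfies $\dim\Delta_G=n$ cannot have value $n$, nor value $-n$, under normal play.
   Context: Games are two-player (Left, Right) short combinatorial games under normal play; value means game value (equivalence class under $G=H$ iff $G-H$ is a second-player win). An SP-game is a placement game on an initially empty board in which pieces are never moved or removed and in which any sequence of moves leading to a reachable position consists of legal moves. Its legal complex $\Delta_G$ has one vertex per basic position (single-piece position), Left basic positions written $x_i$ and Right ones $y_j$, with a set of vertices a face iff the corresponding pieces together form a legal position; from the position corresponding to face $F$, Left (resp. Right) may move to $F\cup\{v\}$ for any Left (resp. Right) vertex $v\notin F$ with $F\cup\{v\}\in\Delta_G$. The dimension of a simplicial complex is the maximum of (face size $-1$). Integers as games: $0=\{\,\mid\,\}$, $n=\{n-1\mid\,\}$ for $n>0$, $n=\{\,\mid n+1\}$ for $n<0$. -}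

module Defs where

open import Data.Nat using (ℕ; zero; suc; _≤_)
open import Data.Integer using (ℤ; +_; -[1+_])
open import Data.Bool using (Bool; true; false)
open import Data.Unit using (⊤; tt)
open import Data.Empty using (⊥)
open import Data.Sum using (_⊎_; inj₁; inj₂; [_,_])
open import Data.Product using (Σ; _×_; ∃; _,_)
open import Data.Fin using (Fin)
open import Data.Fin.Subset using (Subset; _∈_; _∉_; _⊆_; _∪_; ⁅_⁆; ∣_∣)
  renaming (⊥ to ∅)
open import Relation.Binary.PropositionalEquality using (_≡_)

data Game : Set₁ where
  mk : (L R : Set) → (L → Game) → (R → Game) → Game

neg : Game → Game
neg (mk L R gl gr) = mk R L (λ r → neg (gr r)) (λ l → neg (gl l))

_⊕_ : Game → Game → Game
G@(mk L R gl gr) ⊕ H@(mk L' R' hl hr) =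
  mk (L ⊎ L') (R ⊎ R')
     [ (λ a → gl a ⊕ H) , (λ b → G ⊕ hl b) ]
     [ (λ a → gr a ⊕ H) , (λ b → G ⊕ hr b) ]

mutual
  LeftWinsFirst : Game → Set
  LeftWinsFirst (mk L R gl gr) = Σ L λ i → LeftWinsSecond (gl i)

  LeftWinsSecond : Game → Set
  LeftWinsSecond (mk L R gl gr) = (j : R) → LeftWinsFirst (gr j)

mutual
  RightWinsFirst : Game → Set
  RightWinsFirst (mk L R gl gr) = Σ R λ j → RightWinsSecond (gr j)

  RightWinsSecond : Game → Set
  RightWinsSecond (mk L R gl gr) = (i : L) → RightWinsFirst (gl i)

SecondPlayerWin : Game → Set
SecondPlayerWin G = LeftWinsSecond G × RightWinsSecond G

_≈G_ : Game → Game → Set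
G ≈G H = SecondPlayerWin (G ⊕ neg H)

natGame : ℕ → Game
natGame zero = mk ⊥ ⊥ (λ ()) (λ ())
natGame (suc n) = mk ⊤ ⊥ (λ _ → natGame n) (λ ())

negSucGame : ℕ → Game      -- the game -(n+1)
negSucGame zero = mk ⊥ ⊤ (λ ()) (λ _ → natGame zero)
negSucGame (suc n) = mk ⊥ ⊤ (λ ()) (λ _ → negSucGame n)

intGame : ℤ → Game
intGame (+ n) = natGame n
intGame -[1+ n ] = negSucGame n

-- Bicoloured simplicial complexes on vertex set Fin N (legal complexes).
-- isLeft v ≡ true : v is a Left basic position x_i; false : Right y_j.

record LegalComplex (N : ℕ) : Set₁ where
  field
    isLeft    : Fin N → Bool
    Face      : Subset N → Set
    emptyFace : Face ∅
    vertexFace : (v : Fin N) → Face ⁅ v ⁆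
    downClosed : (F G : Subset N) → G ⊆ F → Face F → Face G

open LegalComplex public

HasDimension : {N : ℕ} → LegalComplex N → ℕ → Set
HasDimension Δ n =
  (∃ λ F → Face Δ F × ∣ F ∣ ≡ suc n) ×
  ((F : Subset _) → Face Δ F → ∣ F ∣ ≤ suc n)

LeftMove : {N : ℕ} → LegalComplex N → Subset N → Set
LeftMove Δ F = Σ (Fin _) λ v → (isLeft Δ v ≡ true) × (v ∉ F) × Face Δ (F ∪ ⁅ v ⁆)

RightMove : {N : ℕ} → LegalComplex N → Subset N → Set
RightMove Δ F = Σ (Fin _) λ v → (isLeft Δ v ≡ false) × (v ∉ F) × Face Δ (F ∪ ⁅ v ⁆)

positionGame : {N : ℕ} → LegalComplex N → ℕ → Subset N → Game
positionGame Δ zero F = mk ⊥ ⊥ (λ ()) (λ ())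
positionGame Δ (suc k) F =
  mk (LeftMove Δ F) (RightMove Δ F)
     (λ { (v , _) → positionGame Δ k (F ∪ ⁅ v ⁆) })
     (λ { (v , _) → positionGame Δ k (F ∪ ⁅ v ⁆) })

-- The SP-game determined by its legal complex: start from the empty board.
-- Each move adds a new vertex, so at most N moves occur; fuel N suffices.
spGame : {N : ℕ} → LegalComplex N → Game
spGame {N} Δ = positionGame Δ N ∅

-- If some basic position is Right, Right opens G − n there: afterwards at most n
-- moves remain in G (no face has more than n + 1 vertices), Left can only move
-- in G, and Right answers each such move in −n, which offers him exactly n
-- moves, so Left runs out first.  If every basic position is Left, Right never
-- moves in G, and Left, moving first, plays the n + 1 vertices of a maximal face
-- against Right's n moves in −n.  So G − n is never a second-player win; the
-- value −n is excluded by the mirror argument.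
module Submission where

open import Defs
open import Data.Nat using (ℕ)
open import Data.Integer using (+_; -_)
open import Relation.Nullary using (¬_)
open import Data.Product using (_×_)

open import Data.Nat using (zero; suc; _≤_; _+_; s≤s; z≤n)
open import Data.Nat.Properties using (+-suc; +-identityʳ; m<m+n; 1+n≰n; ≤-trans; ≤-reflexive; module ≤-Reasoning)
open import Data.Bool using (Bool; true; false; not; _≟_)
open import Data.Bool.Properties using (not-¬; ¬-not)
open import Data.Unit using (tt)
open import Data.Empty using (⊥-elim)
open import Data.Sum using (_⊎_; inj₁; inj₂)
open import Data.Product using (Σ; ∃; _,_)
open import Data.Fin using (Fin) renaming (zero to fzero; suc to fsuc)
open import Data.Fin.Subset using (Subset; _∈_; _∉_; _⊆_; _∪_; ⁅_⁆; ∣_∣; inside; outside)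
  renaming (⊥ to ∅)
open import Data.Fin.Subset.Properties
  using (_∈?_; x∈p∪q⁻; x∈⁅y⁆⇒x≡y; ∉⊥; ⊥⊆; ∪-identityˡ; ∪-identityʳ; ∣p∣≤n; ∣⊥∣≡0; ∣⁅x⁆∣≡1; p⊆q⇒∣p∣≤∣q∣)
open import Data.Fin.Properties using (any?)
open import Data.Vec using ([]; _∷_; here; there)
open import Relation.Nullary using (yes; no; ¬?; _×-dec_)
open import Relation.Binary.PropositionalEquality using (_≡_; sym; trans; cong; subst)

mutual
  lws⇒¬rwf : (X : Game) → LeftWinsSecond X → ¬ RightWinsFirst X
  lws⇒¬rwf (mk _ _ _ gr) lws (r , rws) = lwf⇒¬rws (gr r) (lws r) rws

  lwf⇒¬rws : (X : Game) → LeftWinsFirst X → ¬ RightWinsSecond X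
  lwf⇒¬rws (mk _ _ gl _) (l , lws) rws = lws⇒¬rwf (gl l) lws (rws l)

Depth≤ : ℕ → Game → Set
Depth≤ zero    (mk L R _  _)  = ¬ L × ¬ R
Depth≤ (suc k) (mk L R gl gr) = ((l : L) → Depth≤ k (gl l)) × ((r : R) → Depth≤ k (gr r))

-- The shape of −k: only Right ever moves, and every play has exactly k moves.
RightRun : ℕ → Game → Set
RightRun zero    (mk L R _ _)  = ¬ L × ¬ R
RightRun (suc k) (mk L R _ gr) = ¬ L × R × ((r : R) → RightRun k (gr r))

LeftRun : ℕ → Game → Set
LeftRun zero    (mk L R _  _) = ¬ L × ¬ R
LeftRun (suc k) (mk L R gl _) = ¬ R × L × ((l : L) → LeftRun k (gl l))

LeftChain : ℕ → Game → Set
LeftChain zero    (mk L R _  _) = ¬ R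
LeftChain (suc k) (mk L R gl _) = ¬ R × Σ L λ l → LeftChain k (gl l)

RightChain : ℕ → Game → Set
RightChain zero    (mk L R _ _)  = ¬ L
RightChain (suc k) (mk L R _ gr) = ¬ L × Σ R λ r → RightChain k (gr r)

mutual
  depth≤⊕rightRun⇒¬lwf : ∀ k X Y → Depth≤ k X → RightRun k Y → ¬ LeftWinsFirst (X ⊕ Y)
  depth≤⊕rightRun⇒¬lwf zero    (mk _ _ _ _) (mk _ _ _ _) (¬l , _) _ (inj₁ l , _) = ¬l l
  depth≤⊕rightRun⇒¬lwf zero    (mk _ _ _ _) (mk _ _ _ _) _ (¬l , _) (inj₂ l , _) = ¬l l
  depth≤⊕rightRun⇒¬lwf (suc k) (mk _ _ _ _) (mk _ _ _ _) _ (¬l , _) (inj₂ l , _) = ¬l l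
  depth≤⊕rightRun⇒¬lwf (suc k) (mk _ _ gl _) Y@(mk _ _ _ _) (d , _) run (inj₁ l , lws) =
    depth≤⊕rightRun⇒¬lws k (gl l) Y (d l) run lws

  depth≤⊕rightRun⇒¬lws : ∀ k X Y → Depth≤ k X → RightRun (suc k) Y → ¬ LeftWinsSecond (X ⊕ Y)
  depth≤⊕rightRun⇒¬lws k X@(mk _ _ _ _) (mk _ _ _ hr) d (_ , r , run) lws =
    depth≤⊕rightRun⇒¬lwf k X (hr r) d (run r) (lws (inj₂ r))

mutual
  depth≤⊕leftRun⇒¬rwf : ∀ k X Y → Depth≤ k X → LeftRun k Y → ¬ RightWinsFirst (X ⊕ Y)
  depth≤⊕leftRun⇒¬rwf zero    (mk _ _ _ _) (mk _ _ _ _) (_ , ¬r) _ (inj₁ r , _) = ¬r r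
  depth≤⊕leftRun⇒¬rwf zero    (mk _ _ _ _) (mk _ _ _ _) _ (_ , ¬r) (inj₂ r , _) = ¬r r
  depth≤⊕leftRun⇒¬rwf (suc k) (mk _ _ _ _) (mk _ _ _ _) _ (¬r , _) (inj₂ r , _) = ¬r r
  depth≤⊕leftRun⇒¬rwf (suc k) (mk _ _ _ gr) Y@(mk _ _ _ _) (_ , d) run (inj₁ r , rws) =
    depth≤⊕leftRun⇒¬rws k (gr r) Y (d r) run rws

  depth≤⊕leftRun⇒¬rws : ∀ k X Y → Depth≤ k X → LeftRun (suc k) Y → ¬ RightWinsSecond (X ⊕ Y)
  depth≤⊕leftRun⇒¬rws k X@(mk _ _ _ _) (mk _ _ hl _) d (_ , l , run) rws =
    depth≤⊕leftRun⇒¬rwf k X (hl l) d (run l) (rws (inj₂ l))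

mutual
  leftChain⊕rightRun⇒lwf : ∀ k X Y → LeftChain (suc k) X → RightRun k Y → LeftWinsFirst (X ⊕ Y)
  leftChain⊕rightRun⇒lwf k (mk _ _ gl _) Y@(mk _ _ _ _) (_ , l , chain) run =
    inj₁ l , leftChain⊕rightRun⇒lws k (gl l) Y chain run

  leftChain⊕rightRun⇒lws : ∀ k X Y → LeftChain k X → RightRun k Y → LeftWinsSecond (X ⊕ Y)
  leftChain⊕rightRun⇒lws zero    (mk _ _ _ _) (mk _ _ _ _) ¬r _ (inj₁ r) = ⊥-elim (¬r r)
  leftChain⊕rightRun⇒lws zero    (mk _ _ _ _) (mk _ _ _ _) _ (_ , ¬r) (inj₂ r) = ⊥-elim (¬r r)
  leftChain⊕rightRun⇒lws (suc k) (mk _ _ _ _) (mk _ _ _ _) (¬r , _) _ (inj₁ r) = ⊥-elim (¬r r)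
  leftChain⊕rightRun⇒lws (suc k) X@(mk _ _ _ _) (mk _ _ _ hr) chain (_ , _ , run) (inj₂ r) =
    leftChain⊕rightRun⇒lwf k X (hr r) chain (run r)

mutual
  rightChain⊕leftRun⇒rwf : ∀ k X Y → RightChain (suc k) X → LeftRun k Y → RightWinsFirst (X ⊕ Y)
  rightChain⊕leftRun⇒rwf k (mk _ _ _ gr) Y@(mk _ _ _ _) (_ , r , chain) run =
    inj₁ r , rightChain⊕leftRun⇒rws k (gr r) Y chain run

  rightChain⊕leftRun⇒rws : ∀ k X Y → RightChain k X → LeftRun k Y → RightWinsSecond (X ⊕ Y)
  rightChain⊕leftRun⇒rws zero    (mk _ _ _ _) (mk _ _ _ _) ¬l _ (inj₁ l) = ⊥-elim (¬l l)
  rightChain⊕leftRun⇒rws zero    (mk _ _ _ _) (mk _ _ _ _) _ (¬l , _) (inj₂ l) = ⊥-elim (¬l l)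
  rightChain⊕leftRun⇒rws (suc k) (mk _ _ _ _) (mk _ _ _ _) (¬l , _) _ (inj₁ l) = ⊥-elim (¬l l)
  rightChain⊕leftRun⇒rws (suc k) X@(mk _ _ _ _) (mk _ _ hl _) chain (_ , _ , run) (inj₂ l) =
    rightChain⊕leftRun⇒rwf k X (hl l) chain (run l)

neg-intGame-rightRun : ∀ n → RightRun n (neg (intGame (+ n)))
neg-intGame-rightRun zero    = (λ ()) , (λ ())
neg-intGame-rightRun (suc n) = (λ ()) , tt , λ _ → neg-intGame-rightRun n

neg-intGame-leftRun : ∀ n → LeftRun n (neg (intGame (- (+ n))))
neg-intGame-leftRun zero          = (λ ()) , (λ ())
neg-intGame-leftRun (suc zero)    = (λ ()) , tt , λ _ → neg-intGame-leftRun zero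
neg-intGame-leftRun (suc (suc n)) = (λ ()) , tt , λ _ → neg-intGame-leftRun (suc n)

∃≡⊎∀≡not : ∀ {N} (c : Fin N → Bool) (b : Bool) → (∃ λ v → c v ≡ b) ⊎ (∀ v → c v ≡ not b)
∃≡⊎∀≡not c b with any? (λ v → c v ≟ b)
... | yes found = inj₁ found
... | no ¬found = inj₂ λ v → ¬-not λ cv≡b → ¬found (v , cv≡b)

∣p∪⁅x⁆∣≡1+∣p∣ : ∀ {N} (p : Subset N) {x : Fin N} → x ∉ p → ∣ p ∪ ⁅ x ⁆ ∣ ≡ suc ∣ p ∣
∣p∪⁅x⁆∣≡1+∣p∣ (outside ∷ p) {fzero}  _   = cong suc (cong ∣_∣ (∪-identityʳ p))
∣p∪⁅x⁆∣≡1+∣p∣ (inside  ∷ p) {fzero}  x∉p = ⊥-elim (x∉p here)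
∣p∪⁅x⁆∣≡1+∣p∣ (outside ∷ p) {fsuc x} x∉p = ∣p∪⁅x⁆∣≡1+∣p∣ p (λ x∈p → x∉p (there x∈p))
∣p∪⁅x⁆∣≡1+∣p∣ (inside  ∷ p) {fsuc x} x∉p = cong suc (∣p∪⁅x⁆∣≡1+∣p∣ p (λ x∈p → x∉p (there x∈p)))

∣p∪⁅x⁆∣+n≡∣p∣+1+n : ∀ {N} (p : Subset N) {x : Fin N} → x ∉ p → ∀ n → ∣ p ∪ ⁅ x ⁆ ∣ + n ≡ ∣ p ∣ + suc n
∣p∪⁅x⁆∣+n≡∣p∣+1+n p x∉p n = trans (cong (_+ n) (∣p∪⁅x⁆∣≡1+∣p∣ p x∉p)) (sym (+-suc ∣ p ∣ n))

∣p∣<∣q∣⇒∃x∈q∧x∉p : ∀ {N} (p q : Subset N) → suc ∣ p ∣ ≤ ∣ q ∣ → ∃ λ x → x ∈ q × x ∉ p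
∣p∣<∣q∣⇒∃x∈q∧x∉p p q ∣p∣<∣q∣ with any? (λ x → (x ∈? q) ×-dec ¬? (x ∈? p))
... | yes found = found
... | no ¬found = ⊥-elim (1+n≰n (≤-trans ∣p∣<∣q∣ (p⊆q⇒∣p∣≤∣q∣ q⊆p)))
  where
  q⊆p : q ⊆ p
  q⊆p {x} x∈q with x ∈? p
  ... | yes x∈p = x∈p
  ... | no  x∉p = ⊥-elim (¬found (x , x∈q , x∉p))

p⊆q∧x∈q⇒p∪⁅x⁆⊆q : ∀ {N} {p q : Subset N} {x : Fin N} → p ⊆ q → x ∈ q → p ∪ ⁅ x ⁆ ⊆ q
p⊆q∧x∈q⇒p∪⁅x⁆⊆q {p = p} {x = x} p⊆q x∈q {y} y∈p∪x with x∈p∪q⁻ p ⁅ x ⁆ y∈p∪x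
... | inj₁ y∈p = p⊆q y∈p
... | inj₂ y∈x = subst (_∈ _) (sym (x∈⁅y⁆⇒x≡y x y∈x)) x∈q

module _ {N : ℕ} (Δ : LegalComplex N) where

  depth≤-positionGame : ∀ {m} → (∀ F → Face Δ F → ∣ F ∣ ≤ m) →
                        ∀ k fuel F → m ≤ ∣ F ∣ + k → Depth≤ k (positionGame Δ fuel F)
  depth≤-positionGame     bound zero    zero       F _ = (λ ()) , (λ ())
  depth≤-positionGame     bound (suc k) zero       F _ = (λ ()) , (λ ())
  depth≤-positionGame {m} bound zero    (suc fuel) F m≤∣F∣+0 =
    (λ { (_ , _ , x∉F , face) → noRoom x∉F face }) ,
    (λ { (_ , _ , x∉F , face) → noRoom x∉F face })
    where
    noRoom : ∀ {x} → x ∉ F → ¬ Face Δ (F ∪ ⁅ x ⁆)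
    noRoom x∉F face = 1+n≰n (begin
      suc ∣ F ∣         ≡⟨ sym (∣p∪⁅x⁆∣≡1+∣p∣ F x∉F) ⟩
      ∣ F ∪ ⁅ _ ⁆ ∣     ≤⟨ bound _ face ⟩
      m                 ≤⟨ m≤∣F∣+0 ⟩
      ∣ F ∣ + 0         ≡⟨ +-identityʳ ∣ F ∣ ⟩
      ∣ F ∣             ∎)
      where open ≤-Reasoning
  depth≤-positionGame {m} bound (suc k) (suc fuel) F m≤∣F∣+1+k =
    (λ { (_ , _ , x∉F , _) → depth≤-positionGame bound k fuel _ (shift x∉F) }) ,
    (λ { (_ , _ , x∉F , _) → depth≤-positionGame bound k fuel _ (shift x∉F) })
    where
    shift : ∀ {x} → x ∉ F → m ≤ ∣ F ∪ ⁅ x ⁆ ∣ + k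
    shift x∉F = subst (m ≤_) (sym (∣p∪⁅x⁆∣+n≡∣p∣+1+n F x∉F k)) m≤∣F∣+1+k

  module _ {H : Subset N} (faceH : Face Δ H) where

    extendWithin : ∀ {F} k → F ⊆ H → ∣ F ∣ + suc k ≤ ∣ H ∣ →
                   ∃ λ x → x ∉ F × Face Δ (F ∪ ⁅ x ⁆) × F ∪ ⁅ x ⁆ ⊆ H × ∣ F ∪ ⁅ x ⁆ ∣ + k ≤ ∣ H ∣
    extendWithin {F} k F⊆H ∣F∣+1+k≤∣H∣ with ∣p∣<∣q∣⇒∃x∈q∧x∉p F H (≤-trans (m<m+n ∣ F ∣ (s≤s z≤n)) ∣F∣+1+k≤∣H∣)
    ... | x , x∈H , x∉F =
      x , x∉F , downClosed Δ H _ F∪x⊆H faceH , F∪x⊆H ,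
      subst (_≤ ∣ H ∣) (sym (∣p∪⁅x⁆∣+n≡∣p∣+1+n F x∉F k)) ∣F∣+1+k≤∣H∣
      where
      F∪x⊆H : F ∪ ⁅ x ⁆ ⊆ H
      F∪x⊆H = p⊆q∧x∈q⇒p∪⁅x⁆⊆q F⊆H x∈H

    leftChain-positionGame : (∀ x → isLeft Δ x ≡ true) →
                             ∀ k fuel F → k ≤ fuel → F ⊆ H → ∣ F ∣ + k ≤ ∣ H ∣ →
                             LeftChain k (positionGame Δ fuel F)
    leftChain-positionGame allLeft zero    zero       F _ _ _ = λ ()
    leftChain-positionGame allLeft zero    (suc fuel) F _ _ _ = λ { (x , right , _) → not-¬ (allLeft x) right }
    leftChain-positionGame allLeft (suc k) (suc fuel) F (s≤s k≤fuel) F⊆H room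
      with extendWithin k F⊆H room
    ... | x , x∉F , face , F∪x⊆H , room′ =
      (λ { (y , right , _) → not-¬ (allLeft y) right }) ,
      (x , allLeft x , x∉F , face) ,
      leftChain-positionGame allLeft k fuel (F ∪ ⁅ x ⁆) k≤fuel F∪x⊆H room′

    rightChain-positionGame : (∀ x → isLeft Δ x ≡ false) →
                              ∀ k fuel F → k ≤ fuel → F ⊆ H → ∣ F ∣ + k ≤ ∣ H ∣ →
                              RightChain k (positionGame Δ fuel F)
    rightChain-positionGame allRight zero    zero       F _ _ _ = λ ()
    rightChain-positionGame allRight zero    (suc fuel) F _ _ _ = λ { (x , left , _) → not-¬ (allRight x) left }
    rightChain-positionGame allRight (suc k) (suc fuel) F (s≤s k≤fuel) F⊆H room
      with extendWithin k F⊆H room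
    ... | x , x∉F , face , F∪x⊆H , room′ =
      (λ { (y , left , _) → not-¬ (allRight y) left }) ,
      (x , allRight x , x∉F , face) ,
      rightChain-positionGame allRight k fuel (F ∪ ⁅ x ⁆) k≤fuel F∪x⊆H room′

module _ {N n : ℕ} (Δ : LegalComplex (suc N)) {H : Subset (suc N)} (faceH : Face Δ H)
         (∣H∣≡1+n : ∣ H ∣ ≡ suc n) (bound : ∀ F → Face Δ F → ∣ F ∣ ≤ suc n) where

  private
    firstMoveFace : ∀ x → Face Δ (∅ ∪ ⁅ x ⁆)
    firstMoveFace x = subst (Face Δ) (sym (∪-identityˡ ⁅ x ⁆)) (vertexFace Δ x)

    depth≤-afterFirstMove : ∀ x → Depth≤ n (positionGame Δ N (∅ ∪ ⁅ x ⁆))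
    depth≤-afterFirstMove x =
      depth≤-positionGame Δ bound n N _ (≤-reflexive (cong (_+ n) (sym ∣∅∪⁅x⁆∣≡1)))
      where
      ∣∅∪⁅x⁆∣≡1 : ∣ ∅ ∪ ⁅ x ⁆ ∣ ≡ 1
      ∣∅∪⁅x⁆∣≡1 = trans (cong ∣_∣ (∪-identityˡ ⁅ x ⁆)) (∣⁅x⁆∣≡1 x)

    1+n≤1+N : suc n ≤ suc N
    1+n≤1+N = subst (_≤ suc N) ∣H∣≡1+n (∣p∣≤n H)

    room : ∣ ∅ {suc N} ∣ + suc n ≤ ∣ H ∣
    room = ≤-reflexive (trans (cong (_+ suc n) (∣⊥∣≡0 (suc N))) (sym ∣H∣≡1+n))

  spGame⊕rightRun-¬spw : ∀ Y → RightRun n Y → ¬ SecondPlayerWin (spGame Δ ⊕ Y)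
  spGame⊕rightRun-¬spw Y@(mk _ _ _ _) run (lws , rws) with ∃≡⊎∀≡not (isLeft Δ) false
  ... | inj₁ (x , right) =
    depth≤⊕rightRun⇒¬lwf n _ Y (depth≤-afterFirstMove x) run
      (lws (inj₁ (x , right , ∉⊥ , firstMoveFace x)))
  ... | inj₂ allLeft =
    lwf⇒¬rws (spGame Δ ⊕ Y)
      (leftChain⊕rightRun⇒lwf n _ Y
        (leftChain-positionGame Δ faceH allLeft (suc n) (suc N) ∅ 1+n≤1+N ⊥⊆ room) run)
      rws

  spGame⊕leftRun-¬spw : ∀ Y → LeftRun n Y → ¬ SecondPlayerWin (spGame Δ ⊕ Y)
  spGame⊕leftRun-¬spw Y@(mk _ _ _ _) run (lws , rws) with ∃≡⊎∀≡not (isLeft Δ) true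
  ... | inj₁ (x , left) =
    depth≤⊕leftRun⇒¬rwf n _ Y (depth≤-afterFirstMove x) run
      (rws (inj₁ (x , left , ∉⊥ , firstMoveFace x)))
  ... | inj₂ allRight =
    lws⇒¬rwf (spGame Δ ⊕ Y) lws
      (rightChain⊕leftRun⇒rwf n _ Y
        (rightChain-positionGame Δ faceH allRight (suc n) (suc N) ∅ 1+n≤1+N ⊥⊆ room) run)

mainTheorem5 : (n N : ℕ) (Δ : LegalComplex N) → HasDimension Δ n →
    ¬ (spGame Δ ≈G intGame (+ n)) × ¬ (spGame Δ ≈G intGame (- (+ n)))
mainTheorem5 n zero    Δ (([] , _ , ()) , _)
mainTheorem5 n (suc N) Δ ((H , faceH , ∣H∣≡1+n) , bound) =
  spGame⊕rightRun-¬spw Δ faceH ∣H∣≡1+n bound _ (neg-intGame-rightRun n) ,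
  spGame⊕leftRun-¬spw  Δ faceH ∣H∣≡1+n bound _ (neg-intGame-leftRun n)
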